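{- Let $r\ge1$, let $T$ be a finite tree and let $F$ be a blow-up of $T$, where for each $u\in V(T)$ the vertex $u$ is replaced by the independent set $I(u)$. Suppose $F$ is $r$-degenerate. Then there exist an integer $t=t(F)$ and an $(r,t)$-blownup tree $L$, with sets $X_1,\ldots,X_k$, $Y_0,\ldots,Y_k$ as in the definition below, such that $F$ can be embedded in $L$ (i.e., $F$ is isomorphic to a subgraph of $L$) in such a way that for each $u\in V(T)$ the image of $I(u)$ is a subset of some $Y_i$ with $0\le i\le k$.
   Context: A graph is $r$-degenerate if each of its subgraphs has minimum degree at most $r$. A graph $F$ is a blow-up of a graph $T$ if $F$ is obtained from $T$ by replacing each vertex $u$ of $T$ by an independent set $I(u)$ (of arbitrary positive size), the sets being pairwise disjoint, and replacing each edge $uv$ of $T$ by the complete bipartite graph between $I(u)$ and $I(v)$ (with no other edges). For positive integers $r\le t$ and $k$, an $(r,t)$-blownup tree of size $k$ is defined as follows: let $X_1=Y_0,Y_1,\ldots,Y_k$ be pairwise disjoint sets with $|X_1|=r$ and $|Y_1|=\cdots=|Y_k|=t$; for each $2\le i\le k$ let $X_i$ be a subset of size $r$ of some $Y_j$ with $j<i$. The graph with vertex set $Y_0\cup Y_1\cup\cdots\cup Y_k$ and edge set $\bigcup_{1\le i\le k}\{xy: x\in X_i,\ y\in Y_i\}$ is an $(r,t)$-blownup tree of size $k$. -}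

module Defs where

open import Data.Nat using (ℕ; zero; suc; _+_; _≤_; _<_)
open import Data.Fin using (Fin; zero; suc; toℕ)
open import Data.Bool using (Bool; true; false; if_then_else_)
open import Data.List using (List; []; _∷_; length; _∷ʳ_)
open import Data.List.Relation.Unary.Linked using (Linked)
open import Data.List.Relation.Unary.Unique.Propositional using (Unique)
open import Data.Product using (Σ; ∃; ∃-syntax; _×_; _,_; proj₁)
open import Data.Sum using (_⊎_)
open import Data.Empty using (⊥)
open import Relation.Binary.PropositionalEquality using (_≡_)
open import Function.Definitions using (Injective)

record Graph : Set where
  field
    n     : ℕ
    adj   : Fin n → Fin n → Bool
    sym   : ∀ x y → adj x y ≡ adj y x
    irrefl : ∀ x → adj x x ≡ false
open Graph public

Edge : (G : Graph) → Fin (n G) → Fin (n G) → Set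
Edge G x y = adj G x y ≡ true

data Reach (G : Graph) : Fin (n G) → Fin (n G) → Set where
  here : ∀ {x} → Reach G x x
  step : ∀ {x y z} → Edge G x y → Reach G y z → Reach G x z

Connected : Graph → Set
Connected G = ∀ x y → Reach G x y

IsCycle : (G : Graph) → Fin (n G) → List (Fin (n G)) → Set
IsCycle G x xs = (2 ≤ length xs) × Unique (x ∷ xs) × Linked (Edge G) (x ∷ (xs ∷ʳ x))

Acyclic : Graph → Set
Acyclic G = ∀ x xs → IsCycle G x xs → ⊥

IsTree : Graph → Set
IsTree G = (1 ≤ n G) × Connected G × Acyclic G

-- F is a blow-up of T via π : V(F) → V(T), I(u) = π⁻¹(u) (nonempty: π surjective).
IsBlowUpVia : (F T : Graph) → (Fin (n F) → Fin (n T)) → Set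
IsBlowUpVia F T π =
  (∀ u → ∃[ x ] π x ≡ u) × (∀ x y → adj F x y ≡ adj T (π x) (π y))

countTrue : ∀ {m} → (Fin m → Bool) → ℕ
countTrue {zero} f = 0
countTrue {suc m} f = (if f zero then 1 else 0) + countTrue (λ i → f (suc i))

IsSubgraph : (G : Graph) → (Fin (n G) → Bool) → (Fin (n G) → Fin (n G) → Bool) → Set
IsSubgraph G S E =
  (∀ x y → E x y ≡ true → (adj G x y ≡ true) × (S x ≡ true) × (S y ≡ true))
  × (∀ x y → E x y ≡ E y x)

Degenerate : ℕ → Graph → Set
Degenerate r G = ∀ S E → IsSubgraph G S E → (∃[ v ] S v ≡ true) →
  ∃[ v ] (S v ≡ true) × (countTrue (E v) ≤ r)

-- Sets indexed by Fin (suc k): index zero is Y_0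
-- (size r), index suc i is Y_{i+1} (size t).  For each i : Fin k (standing for
-- Y_{i+1}) a parent j with j < i+1 and an injection Fin r → Y_j giving X_{i+1}.
-- (For i = 0 this forces X_1 = Y_0.)
ysize : ℕ → ℕ → ∀ {k} → Fin (suc k) → ℕ
ysize r t zero = r
ysize r t (suc _) = t

record BlownupTree (r t k : ℕ) : Set where
  field
    par    : Fin k → Fin (suc k)
    par<   : ∀ i → toℕ (par i) ≤ toℕ i
    emb    : (i : Fin k) → Fin r → Fin (ysize r t (par i))
    embInj : ∀ i → Injective _≡_ _≡_ (emb i)
open BlownupTree public

BTVertex : (r t k : ℕ) → Set
BTVertex r t k = Σ (Fin (suc k)) (λ j → Fin (ysize r t j))

-- x ∈ X_{i+1} and y ∈ Y_{i+1}
BTArc : ∀ {r t k} → BlownupTree r t k → BTVertex r t k → BTVertex r t k → Set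
BTArc {r} {t} {k} L x y =
  ∃[ i ] ∃[ c ] (x ≡ (par L i , emb L i c)) × (proj₁ y ≡ suc i)

BTAdj : ∀ {r t k} → BlownupTree r t k → BTVertex r t k → BTVertex r t k → Set
BTAdj L x y = BTArc L x y ⊎ BTArc L y x

-- F embeds in L (injective homomorphism = isomorphic to a subgraph of L).
IsEmbedding : ∀ {r t k} (F : Graph) → BlownupTree r t k → (Fin (n F) → BTVertex r t k) → Set
IsEmbedding F L φ = Injective _≡_ _≡_ φ × (∀ x y → Edge F x y → BTAdj L (φ x) (φ y))

-- Root T and call a vertex u large when |I(u)| > r.  Applying degeneracy to I(u) together with
-- its neighbourhood shows that the classes adjacent to a large class have at most r vertices in
-- total; in particular no two large classes are adjacent.  Every vertex u of T gets its own set
-- Y_u of size |F| + r, attached through an r-set X_u to the set holding the class of the parent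
-- of u.  The class I(u) goes into Y_u, unless the parent p of u is large: then I(u) goes into the
-- set holding X_p, which can therefore cover all classes adjacent to I(p).  An edge of F between
-- a parent class I(p) and a child class I(u) then runs from X_p to Y_p when p is large, and from
-- X_u ⊇ I(p) to Y_u otherwise.  Numbering the sets by increasing depth makes every set come after the
-- set it is attached to.

module Submission where

open import Defs hiding (sym)
open import Data.Bool using (Bool; true; false; _∧_; _∨_)
import Data.Bool as Bool
open import Data.Bool.Properties using (∨-zeroʳ)
open import Data.Empty using (⊥; ⊥-elim)
open import Data.Fin using (Fin; zero; suc; toℕ; fromℕ<; _↑ˡ_; combine; remQuot; _≟_)
import Data.Fin.Properties as Finₚ
open import Data.List using (List; []; _∷_; _++_; [_]; length)
open import Data.List.Properties using (length-++)
open import Data.List.Relation.Unary.All as All using (All; []; _∷_)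
import Data.List.Relation.Unary.All.Properties as All
open import Data.List.Relation.Unary.AllPairs using ([]; _∷_)
import Data.List.Relation.Unary.AllPairs.Properties as AllPairs
open import Data.List.Relation.Unary.Linked using (Linked; []; [-]; _∷_)
open import Data.List.Relation.Unary.Unique.Propositional using (Unique)
open import Data.Maybe using (Maybe; just; nothing)
import Data.Maybe.Relation.Unary.All as Maybe
open import Data.Nat using (ℕ; zero; suc; pred; _+_; _*_; _≤_; _<_; z≤n; s≤s; s≤s⁻¹; _⊔_; _<?_; _≤?_)
open import Data.Nat.Induction using (<-rec)
open import Data.Nat.Properties hiding (_≟_)
open import Data.Product using (Σ; Σ-syntax; ∃-syntax; _×_; _,_; proj₁; proj₂)
open import Data.Sum using (_⊎_; inj₁; inj₂; swap)
open import Function using (_∘_; id; case_of_)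
open import Function.Definitions using (Injective)
open import Relation.Binary.Definitions using (tri<; tri≈; tri>)
open import Relation.Binary.PropositionalEquality
  using (_≡_; _≢_; refl; sym; trans; cong; cong₂; subst; subst₂; module ≡-Reasoning)
open import Relation.Nullary using (¬_; Dec; does; yes; no; _×-dec_)
open import Relation.Nullary.Decidable using (dec-true)
open import Relation.Unary using (Decidable)

least : ∀ {P : ℕ → Set} → Decidable P → ∀ m → P m → Σ[ n ∈ ℕ ] P n × (∀ k → P k → n ≤ k)
least P? = <-rec _ λ m rec Pm → case anyUpTo? P? m of λ where
  (yes (k , k<m , Pk)) → rec k<m Pk
  (no none)            → m , Pm , λ k Pk → ≮⇒≥ λ k<m → none (k , k<m , Pk)

bounded : ∀ {m} (f : Fin m → ℕ) → ∃[ B ] (∀ i → f i ≤ B)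
bounded {zero}  f = 0 , λ ()
bounded {suc m} f with B , f∘suc≤B ← bounded (f ∘ suc) = f zero ⊔ B , λ where
  zero    → m≤m⊔n (f zero) B
  (suc i) → ≤-trans (f∘suc≤B i) (m≤n⊔m (f zero) B)

clamp : ∀ {m} → Fin (suc m) → Fin m → Fin (suc m)
clamp s j with toℕ s ≤? toℕ j
... | yes _ = s
... | no  _ = zero

clamp-≤ : ∀ {m} (s : Fin (suc m)) (j : Fin m) → toℕ (clamp s j) ≤ toℕ j
clamp-≤ s j with toℕ s ≤? toℕ j
... | yes s≤j = s≤j
... | no  _   = z≤n

clamp-≡ : ∀ {m} {s : Fin (suc m)} {j : Fin m} → toℕ s ≤ toℕ j → clamp s j ≡ s
clamp-≡ {s = s} {j} s≤j with toℕ s ≤? toℕ j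
... | yes _   = refl
... | no  s≰j = ⊥-elim (s≰j s≤j)

∧-≡true : ∀ {a b} → a ≡ true → b ≡ true → a ∧ b ≡ true
∧-≡true refl refl = refl

∨-≡trueˡ : ∀ {a} b → a ≡ true → a ∨ b ≡ true
∨-≡trueˡ _ refl = refl

∨-≡trueʳ : ∀ a {b} → b ≡ true → a ∨ b ≡ true
∨-≡trueʳ a refl = ∨-zeroʳ a

does-true : ∀ {A : Set} (a? : Dec A) → does a? ≡ true → A
does-true (yes a) _ = a

countTrue-mono : ∀ {m} {f g : Fin m → Bool} → (∀ i → f i ≡ true → g i ≡ true) →
                 countTrue f ≤ countTrue g
countTrue-mono {zero} f⇒g = z≤n
countTrue-mono {suc m} {f} {g} f⇒g with f zero in f₀ | g zero in g₀
... | true  | true  = s≤s (countTrue-mono (f⇒g ∘ suc))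
... | true  | false with () ← trans (sym (f⇒g zero f₀)) g₀
... | false | true  = m≤n⇒m≤1+n (countTrue-mono (f⇒g ∘ suc))
... | false | false = countTrue-mono (f⇒g ∘ suc)

countTrue-false : ∀ m → countTrue {m} (λ _ → false) ≡ 0
countTrue-false zero    = refl
countTrue-false (suc m) = countTrue-false m

cover : ∀ {r t} → r ≤ t → (S : Fin t → Bool) → countTrue S ≤ r →
        Σ[ f ∈ (Fin r → Fin t) ] Injective _≡_ _≡_ f × (∀ y → S y ≡ true → ∃[ c ] f c ≡ y)
cover {t = zero} z≤n S _ = (λ ()) , (λ {}) , λ ()
cover {r} {suc t} r≤1+t S bound with S zero in S₀
cover {suc r} {suc t} (s≤s r≤t) S (s≤s bound) | true
  with f , f-inj , f-covers ← cover r≤t (S ∘ suc) bound = g , g-inj , g-covers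
  where
  g : Fin (suc r) → Fin (suc t)
  g zero    = zero
  g (suc c) = suc (f c)
  g-inj : Injective _≡_ _≡_ g
  g-inj {zero}  {zero}  _  = refl
  g-inj {suc _} {suc _} eq = cong suc (f-inj (Finₚ.suc-injective eq))
  g-covers : ∀ y → S y ≡ true → ∃[ c ] g c ≡ y
  g-covers zero    _  = zero , refl
  g-covers (suc y) Sy with c , refl ← f-covers y Sy = suc c , refl
... | false with m≤n⇒m<n∨m≡n r≤1+t
...   | inj₂ refl = id , id , λ y _ → y , refl
...   | inj₁ (s≤s r≤t) with f , f-inj , f-covers ← cover r≤t (S ∘ suc) bound =
  suc ∘ f , f-inj ∘ Finₚ.suc-injective , covers
  where
  covers : ∀ y → S y ≡ true → ∃[ c ] suc (f c) ≡ y
  covers zero    S₀′ with () ← trans (sym S₀) S₀′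
  covers (suc y) Sy with c , refl ← f-covers y Sy = c , refl

padFalse : ∀ {m} r → (Fin m → Bool) → Fin (m + r) → Bool
padFalse {zero}  r S _       = false
padFalse {suc m} r S zero    = S zero
padFalse {suc m} r S (suc p) = padFalse r (S ∘ suc) p

countTrue-padFalse : ∀ {m} r (S : Fin m → Bool) → countTrue (padFalse r S) ≡ countTrue S
countTrue-padFalse {zero}  r S = countTrue-false r
countTrue-padFalse {suc m} r S = cong (_ +_) (countTrue-padFalse r (S ∘ suc))

padFalse-↑ˡ : ∀ {m} r (S : Fin m → Bool) x → padFalse r S (x ↑ˡ r) ≡ S x
padFalse-↑ˡ r S zero    = refl
padFalse-↑ˡ r S (suc x) = padFalse-↑ˡ r (S ∘ suc) x

cover-↑ˡ : ∀ {m} r (S : Fin m → Bool) → countTrue S ≤ r →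
           Σ[ f ∈ (Fin r → Fin (m + r)) ] Injective _≡_ _≡_ f × (∀ x → S x ≡ true → ∃[ c ] f c ≡ x ↑ˡ r)
cover-↑ˡ {m} r S bound
  with f , f-inj , f-covers ← cover (m≤n+m r m) (padFalse r S) (≤-trans (≤-reflexive (countTrue-padFalse r S)) bound)
  = f , f-inj , λ x Sx → f-covers (x ↑ˡ r) (trans (padFalse-↑ˡ r S x) Sx)

linked-∷ʳ⁺ : ∀ {A : Set} {R : A → A → Set} xs {y z} → Linked R (xs ++ [ y ]) → R y z →
             Linked R ((xs ++ [ y ]) ++ [ z ])
linked-∷ʳ⁺ []               _          Ryz = Ryz ∷ [-]
linked-∷ʳ⁺ (_ ∷ [])         (Rxy ∷ _)  Ryz = Rxy ∷ Ryz ∷ [-]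
linked-∷ʳ⁺ (_ ∷ xs@(_ ∷ _)) (Rxx ∷ Rs) Ryz = Rxx ∷ linked-∷ʳ⁺ xs Rs Ryz

unique-∷ʳ⁺ : ∀ {A : Set} {xs : List A} {y} → Unique xs → All (_≢ y) xs → Unique (xs ++ [ y ])
unique-∷ʳ⁺ u xs≢y = AllPairs.++⁺ u ([] ∷ []) (All.map (_∷ []) xs≢y)

edge-sym : ∀ (G : Graph) {x y} → Edge G x y → Edge G y x
edge-sym G {x} {y} e = trans (Graph.sym G y x) e

edge-irrefl : ∀ (G : Graph) {x} → ¬ Edge G x x
edge-irrefl G {x} e with () ← trans (sym e) (irrefl G x)

induced : (G : Graph) → (Fin (n G) → Bool) → Fin (n G) → Fin (n G) → Bool
induced G S x y = S x ∧ (S y ∧ adj G x y)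

induced-subgraph : ∀ G S → IsSubgraph G S (induced G S)
induced-subgraph G S = inside , symmetric
  where
  inside : ∀ x y → induced G S x y ≡ true → (adj G x y ≡ true) × (S x ≡ true) × (S y ≡ true)
  inside x y e with S x | S y | adj G x y
  inside x y e | true | true | true = refl , refl , refl
  symmetric : ∀ x y → induced G S x y ≡ induced G S y x
  symmetric x y with S x | S y
  ... | true  | true  = Graph.sym G x y
  ... | true  | false = refl
  ... | false | true  = refl
  ... | false | false = refl

low-degree-vertex : ∀ {r G} → Degenerate r G → (S : Fin (n G) → Bool) → ∃[ x ] S x ≡ true →
                    ∃[ v ] S v ≡ true × countTrue (λ y → S y ∧ adj G v y) ≤ r
low-degree-vertex {r} {G} degenerate S nonempty
  with v , Sv , deg-v ← degenerate S (induced G S) (induced-subgraph G S) nonempty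
  = v , Sv , subst (λ b → countTrue (λ y → b ∧ (S y ∧ adj G v y)) ≤ r) Sv deg-v

module RootedTree (T : Graph) (root : Fin (n T)) (connected : Connected T) (acyclic : Acyclic T) where

  V : Set
  V = Fin (n T)

  RootWalk : ℕ → V → Set
  RootWalk zero    v = v ≡ root
  RootWalk (suc ℓ) v = ∃[ u ] RootWalk ℓ u × Edge T u v

  rootWalk? : ∀ ℓ → Decidable (RootWalk ℓ)
  rootWalk? zero    v = v ≟ root
  rootWalk? (suc ℓ) v = Finₚ.any? λ u → rootWalk? ℓ u ×-dec (adj T u v Bool.≟ true)

  rootWalk-reach : ∀ {ℓ u v} → RootWalk ℓ u → Reach T u v → ∃[ m ] RootWalk m v
  rootWalk-reach w here                = _ , w
  rootWalk-reach {u = u} w (step e uv) = rootWalk-reach (u , w , e) uv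

  depth-spec : ∀ v → Σ[ d ∈ ℕ ] RootWalk d v × (∀ ℓ → RootWalk ℓ v → d ≤ ℓ)
  depth-spec v with ℓ , w ← rootWalk-reach {0} refl (connected root v) =
    least (λ ℓ → rootWalk? ℓ v) ℓ w

  depth : V → ℕ
  depth v = proj₁ (depth-spec v)

  rootWalk-depth : ∀ v → RootWalk (depth v) v
  rootWalk-depth v = proj₁ (proj₂ (depth-spec v))

  depth-least : ∀ {ℓ v} → RootWalk ℓ v → depth v ≤ ℓ
  depth-least {ℓ} {v} = proj₂ (proj₂ (depth-spec v)) ℓ

  depth-edge : ∀ {u v} → Edge T u v → depth v ≤ suc (depth u)
  depth-edge {u} e = depth-least (u , rootWalk-depth u , e)

  depth≡0⇒root : ∀ {v} → depth v ≡ 0 → v ≡ root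
  depth≡0⇒root {v} d≡0 = subst (λ ℓ → RootWalk ℓ v) d≡0 (rootWalk-depth v)

  depth≢⇒≢ : ∀ {u v} → depth u ≢ depth v → u ≢ v
  depth≢⇒≢ d≢ refl = d≢ refl

  predecessor : ∀ ℓ {v} → RootWalk ℓ v → V
  predecessor zero    {v} _       = v
  predecessor (suc ℓ)     (u , _) = u

  parent : V → V
  parent v = predecessor (depth v) (rootWalk-depth v)

  depth-parent : ∀ v → depth (parent v) ≡ pred (depth v)
  depth-parent v = go (depth v) (rootWalk-depth v) refl
    where
    go : ∀ ℓ (w : RootWalk ℓ v) → depth v ≡ ℓ → depth (predecessor ℓ w) ≡ pred ℓ
    go zero    _           d≡0  = d≡0
    go (suc ℓ) (u , w , e) d≡1+ℓ =
      ≤-antisym (depth-least w) (s≤s⁻¹ (≤-trans (≤-reflexive (sym d≡1+ℓ)) (depth-edge e)))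

  parent-edge : ∀ {ℓ v} → depth v ≡ suc ℓ → Edge T (parent v) v
  parent-edge {v = v} = go (depth v) (rootWalk-depth v)
    where
    go : ∀ {ℓ} m (w : RootWalk m v) → m ≡ suc ℓ → Edge T (predecessor m w) v
    go (suc _) (_ , _ , e) _ = e

  depth-parent-≤ : ∀ u → depth (parent u) ≤ depth u
  depth-parent-≤ u = ≤-trans (≤-reflexive (depth-parent u)) pred[n]≤n

  depth-parent-suc : ∀ {ℓ v} → depth v ≡ suc ℓ → depth (parent v) ≡ ℓ
  depth-parent-suc {v = v} d≡1+ℓ = trans (depth-parent v) (cong pred d≡1+ℓ)

  record Detour (ℓ : ℕ) (a b : V) : Set where
    field
      inner    : List V
      nonempty : 1 ≤ length inner
      linked   : Linked (Edge T) (a ∷ inner ++ [ b ])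
      unique   : Unique (a ∷ inner ++ [ b ])
      shallow  : All (λ z → depth z ≤ ℓ) (a ∷ inner ++ [ b ])
  open Detour

  -- Climb from a and b towards the root until the two ancestor chains meet.
  detour : ∀ ℓ {a b} → depth a ≡ ℓ → depth b ≡ ℓ → a ≢ b → Detour ℓ a b
  detour zero da db a≢b = ⊥-elim (a≢b (trans (depth≡0⇒root da) (sym (depth≡0⇒root db))))
  detour (suc ℓ) {a} {b} da db a≢b with parent a ≟ parent b
  ... | yes pa≡pb = record
    { inner    = [ parent a ]
    ; nonempty = ≤-refl
    ; linked   = edge-sym T (parent-edge da) ∷ subst (λ w → Edge T w b) (sym pa≡pb) (parent-edge db) ∷ [-]
    ; unique   = (a≢pa ∷ a≢b ∷ []) ∷ (pa≢b ∷ []) ∷ [] ∷ []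
    ; shallow  = ≤-reflexive da ∷ ≤-trans (≤-reflexive dpa) (n≤1+n ℓ) ∷ ≤-reflexive db ∷ []
    }
    where
    dpa : depth (parent a) ≡ ℓ
    dpa = depth-parent-suc da
    a≢pa : a ≢ parent a
    a≢pa = depth≢⇒≢ λ eq → 1+n≢n (trans (sym da) (trans eq dpa))
    pa≢b : parent a ≢ b
    pa≢b = depth≢⇒≢ λ eq → 1+n≢n (trans (sym db) (trans (sym eq) dpa))
  ... | no pa≢pb = record
    { inner    = path
    ; nonempty = s≤s z≤n
    ; linked   = edge-sym T (parent-edge da) ∷ linked-∷ʳ⁺ (parent a ∷ inner D) (linked D) (parent-edge db)
    ; unique   = All.∷ʳ⁺ (All.map (λ zℓ → depth≢⇒≢ (deeper da zℓ)) (shallow D)) a≢b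
                 ∷ unique-∷ʳ⁺ (unique D) (All.map (λ zℓ → depth≢⇒≢ (deeper db zℓ) ∘ sym) (shallow D))
    ; shallow  = ≤-reflexive da ∷ All.∷ʳ⁺ (All.map (λ zℓ → m≤n⇒m≤1+n zℓ) (shallow D)) (≤-reflexive db)
    }
    where
    D = detour ℓ (depth-parent-suc da) (depth-parent-suc db) pa≢pb
    path : List V
    path = parent a ∷ inner D ++ [ parent b ]
    deeper : ∀ {x z} → depth x ≡ suc ℓ → depth z ≤ ℓ → depth x ≢ depth z
    deeper dx zℓ eq = 1+n≰n (≤-trans (≤-reflexive (trans (sym dx) eq)) zℓ)

  edge⇒depth≢ : ∀ {u v} → Edge T u v → depth u ≢ depth v
  edge⇒depth≢ {u} {v} e du≡dv with u ≟ v
  ... | yes refl = edge-irrefl T e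
  ... | no u≢v   = acyclic u (inner D ++ [ v ]) (long , unique D , linked-∷ʳ⁺ (u ∷ inner D) (linked D) (edge-sym T e))
    where
    D = detour (depth u) refl (sym du≡dv) u≢v
    long : 2 ≤ length (inner D ++ [ v ])
    long = ≤-trans (+-monoˡ-≤ 1 (nonempty D)) (≤-reflexive (sym (length-++ (inner D))))

  edge⇒parent : ∀ {u v} → Edge T u v → depth v ≡ suc (depth u) → parent v ≡ u
  edge⇒parent {u} {v} e dv with parent v ≟ u
  ... | yes pv≡u = pv≡u
  ... | no pv≢u  = ⊥-elim (acyclic v (u ∷ inner D ++ [ parent v ]) (long , v-fresh ∷ unique D , cycle))
    where
    D = detour (depth u) refl (depth-parent-suc dv) (pv≢u ∘ sym)
    long : 2 ≤ length (u ∷ inner D ++ [ parent v ])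
    long = s≤s (≤-trans (m≤n+m 1 _) (≤-reflexive (sym (length-++ (inner D)))))
    v-fresh : All (v ≢_) (u ∷ inner D ++ [ parent v ])
    v-fresh = All.map (λ zu → depth≢⇒≢ λ eq → 1+n≰n (≤-trans (≤-reflexive (trans (sym dv) eq)) zu)) (shallow D)
    cycle : Linked (Edge T) (v ∷ (u ∷ inner D ++ [ parent v ]) ++ [ v ])
    cycle = edge-sym T e ∷ linked-∷ʳ⁺ (u ∷ inner D) (linked D) (parent-edge dv)

  ChildOf : V → V → Set
  ChildOf v u = parent v ≡ u × depth v ≡ suc (depth u)

  child-edge : ∀ {u v} → ChildOf v u → Edge T u v
  child-edge {v = v} (pv≡u , dv) = subst (λ w → Edge T w v) pv≡u (parent-edge dv)

  edge⇒child : ∀ {u v} → Edge T u v → ChildOf v u ⊎ ChildOf u v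
  edge⇒child {u} {v} e with <-cmp (depth u) (depth v)
  ... | tri< du<dv _ _ = inj₁ (edge⇒parent e dv , dv)
    where dv = ≤-antisym (depth-edge e) du<dv
  ... | tri≈ _ du≡dv _ = ⊥-elim (edge⇒depth≢ e du≡dv)
  ... | tri> _ _ dv<du = inj₂ (edge⇒parent (edge-sym T e) du , du)
    where du = ≤-antisym (depth-edge (edge-sym T e)) dv<du

classSize : ∀ {m k} → (Fin m → Fin k) → Fin k → ℕ
classSize π u = countTrue (λ x → does (π x ≟ u))

module LargeClasses (r : ℕ) (F T : Graph) (π : Fin (n F) → Fin (n T))
                    (blowUp : IsBlowUpVia F T π) (degenerate : Degenerate r F) where

  closedNeighbourhood : Fin (n T) → Fin (n F) → Bool
  closedNeighbourhood u x = does (π x ≟ u) ∨ adj T (π x) u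

  large-neighbourhood : ∀ {u} → r < classSize π u → countTrue (λ x → adj T (π x) u) ≤ r
  large-neighbourhood {u} large
    with x₀ , πx₀≡u ← proj₁ blowUp u
    with v , v∈N , deg-v ← low-degree-vertex {r} {F} degenerate (closedNeighbourhood u)
                             (x₀ , ∨-≡trueˡ _ (dec-true (π x₀ ≟ u) πx₀≡u))
    with π v ≟ u
  ... | yes πv≡u = ≤-trans (countTrue-mono neighbour) deg-v
    where
    neighbour : ∀ x → adj T (π x) u ≡ true → closedNeighbourhood u x ∧ adj F v x ≡ true
    neighbour x e = ∧-≡true (∨-≡trueʳ _ e)
      (trans (proj₂ blowUp v x) (trans (cong (λ w → adj T w (π x)) πv≡u) (edge-sym T e)))
  ... | no πv≢u = ⊥-elim (<⇒≱ large (≤-trans (countTrue-mono member) deg-v))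
    where
    -- once π v ≢ u is known, v∈N has been reduced to this edge
    πv~u : Edge T (π v) u
    πv~u = v∈N
    member : ∀ x → does (π x ≟ u) ≡ true → closedNeighbourhood u x ∧ adj F v x ≡ true
    member x e = ∧-≡true (∨-≡trueˡ _ e)
      (trans (proj₂ blowUp v x) (trans (cong (adj T (π v)) (does-true (π x ≟ u) e)) πv~u))

  large-nonadjacent : ∀ {u v} → Edge T u v → r < classSize π u → r < classSize π v → ⊥
  large-nonadjacent {u} {v} e large-u large-v =
    <⇒≱ large-v (≤-trans (countTrue-mono member) (large-neighbourhood large-u))
    where
    member : ∀ x → does (π x ≟ v) ≡ true → adj T (π x) u ≡ true
    member x πx≡v = trans (cong (λ w → adj T w u) (does-true (π x ≟ v) πx≡v)) (edge-sym T e)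

module Embedding (r : ℕ) (T F : Graph) (root : Fin (n T)) (connected : Connected T) (acyclic : Acyclic T)
                    (π : Fin (n F) → Fin (n T)) (blowUp : IsBlowUpVia F T π) (degenerate : Degenerate r F) where

  open RootedTree T root connected acyclic
  open LargeClasses r F T π blowUp degenerate
  open ≡-Reasoning

  Large : V → Set
  Large u = r < classSize π u

  large? : Decidable Large
  large? u = r <? classSize π u

  -- home u is the set holding I(u) and uplink u the one holding X_u, where just v is Y_v and
  -- nothing is Y_1; homeAt and uplinkAt compute them with the depth as fuel.
  homeAt uplinkAt : ℕ → V → Maybe V
  homeAt zero    u = just u
  homeAt (suc ℓ) u with large? (parent u)
  ... | yes _ = uplinkAt ℓ (parent u)
  ... | no  _ = just u
  uplinkAt zero    _ = nothing
  uplinkAt (suc ℓ) u = homeAt ℓ (parent u)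

  home uplink : V → Maybe V
  home   u = homeAt (depth u) u
  uplink u = uplinkAt (depth u) u

  uplink≡home-parent : ∀ {ℓ u} → depth u ≡ suc ℓ → uplink u ≡ home (parent u)
  uplink≡home-parent {ℓ} {u} d≡1+ℓ = trans (cong (λ m → uplinkAt m u) d≡1+ℓ)
                                        (cong (λ m → homeAt m (parent u)) (sym (depth-parent-suc d≡1+ℓ)))

  homeAt-large : ∀ ℓ u → Large (parent u) → homeAt (suc ℓ) u ≡ uplinkAt ℓ (parent u)
  homeAt-large ℓ u large with large? (parent u)
  ... | yes _     = refl
  ... | no  small = ⊥-elim (small large)

  homeAt-small : ∀ ℓ u → ¬ Large (parent u) → homeAt (suc ℓ) u ≡ just u
  homeAt-small ℓ u small with large? (parent u)
  ... | yes large = ⊥-elim (small large)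
  ... | no  _     = refl

  home-under-large : ∀ {ℓ u} → depth u ≡ suc ℓ → Large (parent u) → home u ≡ uplink (parent u)
  home-under-large {ℓ} {u} d≡1+ℓ large = begin
    homeAt (depth u) u                     ≡⟨ cong (λ m → homeAt m u) d≡1+ℓ ⟩
    homeAt (suc ℓ) u                       ≡⟨ homeAt-large ℓ u large ⟩
    uplinkAt ℓ (parent u)                  ≡⟨ cong (λ m → uplinkAt m (parent u)) (sym (depth-parent-suc d≡1+ℓ)) ⟩
    uplinkAt (depth (parent u)) (parent u) ∎

  home-under-small : ∀ {ℓ u} → depth u ≡ suc ℓ → ¬ Large (parent u) → home u ≡ just u
  home-under-small {ℓ} {u} d≡1+ℓ small = trans (cong (λ m → homeAt m u) d≡1+ℓ) (homeAt-small ℓ u small)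

  home-large : ∀ {u} → Large u → home u ≡ just u
  home-large {u} large = go (depth u) refl
    where
    go : ∀ ℓ → depth u ≡ ℓ → home u ≡ just u
    go zero    d≡0   = cong (λ m → homeAt m u) d≡0
    go (suc ℓ) d≡1+ℓ = home-under-small d≡1+ℓ λ large-parent →
      large-nonadjacent (parent-edge d≡1+ℓ) large-parent large

  homeAt-shallow : ∀ ℓ u → Maybe.All (λ a → depth a ≤ depth u) (homeAt ℓ u)
  uplinkAt-shallow : ∀ ℓ u → Maybe.All (λ a → depth a ≤ depth (parent u)) (uplinkAt ℓ u)
  homeAt-shallow zero    u = Maybe.just ≤-refl
  homeAt-shallow (suc ℓ) u with large? (parent u)
  ... | yes _ = Maybe.map (λ a≤ → ≤-trans a≤ (≤-trans (depth-parent-≤ (parent u)) (depth-parent-≤ u)))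
                          (uplinkAt-shallow ℓ (parent u))
  ... | no  _ = Maybe.just ≤-refl
  uplinkAt-shallow zero    u = Maybe.nothing
  uplinkAt-shallow (suc ℓ) u = homeAt-shallow ℓ (parent u)

  uplink-shallower : ∀ u → Maybe.All (λ a → depth a < depth u) (uplink u)
  uplink-shallower u = go (depth u) refl
    where
    go : ∀ ℓ → depth u ≡ ℓ → Maybe.All (λ a → depth a < ℓ) (uplinkAt ℓ u)
    go zero    _      = Maybe.nothing
    go (suc ℓ) d≡1+ℓ = Maybe.map (λ a≤ → s≤s (≤-trans a≤ (≤-reflexive (depth-parent-suc d≡1+ℓ))))
                                 (homeAt-shallow ℓ (parent u))

  N t : ℕ
  N = n F
  t = N + r

  -- What X_u must cover: the neighbours of I(u) if u is large, else I(parent u) unless the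
  -- parent is large (edges at a large class run through its own X-set).
  wanted : V → Fin N → Bool
  wanted u with large? u | large? (parent u)
  ... | yes _ | _     = λ x → adj T (π x) u
  ... | no  _ | yes _ = λ _ → false
  ... | no  _ | no  _ = λ x → does (π x ≟ parent u)

  wanted-bound : ∀ u → countTrue (wanted u) ≤ r
  wanted-bound u with large? u | large? (parent u)
  ... | yes large | _         = large-neighbourhood large
  ... | no  _     | yes _     = ≤-trans (≤-reflexive (countTrue-false N)) z≤n
  ... | no  _     | no  small = ≮⇒≥ small

  wanted-large : ∀ {u x} → Large u → Edge T (π x) u → wanted u x ≡ true
  wanted-large {u} large e with large? u | large? (parent u)
  ... | yes _     | _ = e
  ... | no  small | _ = ⊥-elim (small large)

  wanted-parent : ∀ {u x} → π x ≡ parent u → Edge T (π x) u → ¬ Large (parent u) → wanted u x ≡ true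
  wanted-parent {u} {x} πx≡pu e small-parent with large? u | large? (parent u)
  ... | yes _ | _         = e
  ... | no  _ | yes large = ⊥-elim (small-parent large)
  ... | no  _ | no  _     = dec-true (π x ≟ parent u) πx≡pu

  xset : V → Fin r → Fin t
  xset u = proj₁ (cover-↑ˡ r (wanted u) (wanted-bound u))

  xset-injective : ∀ u → Injective _≡_ _≡_ (xset u)
  xset-injective u = proj₁ (proj₂ (cover-↑ˡ r (wanted u) (wanted-bound u)))

  xset-covers : ∀ u x → wanted u x ≡ true → ∃[ c ] xset u c ≡ x ↑ˡ r
  xset-covers u = proj₂ (proj₂ (cover-↑ˡ r (wanted u) (wanted-bound u)))

  B K k : ℕ
  B = proj₁ (bounded depth)
  K = suc B * n T
  k = suc K

  level : V → Fin (suc B)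
  level u = fromℕ< (s≤s (proj₂ (bounded depth) u))

  key : V → Fin K
  key u = combine (level u) u

  key-< : ∀ {a u} → depth a < depth u → toℕ (key a) < toℕ (key u)
  key-< {a} {u} da<du = Finₚ.combine-monoˡ-< a u
    (subst₂ _<_ (sym (Finₚ.toℕ-fromℕ< _)) (sym (Finₚ.toℕ-fromℕ< _)) da<du)

  vertexOf : Fin K → V
  vertexOf j = proj₂ (remQuot {suc B} (n T) j)

  vertexOf-key : ∀ u → vertexOf (key u) ≡ u
  vertexOf-key u = cong proj₂ (Finₚ.remQuot-combine (level u) u)

  slot : Maybe V → Fin k
  slot nothing  = zero
  slot (just u) = suc (key u)

  slot-uplink : ∀ u → toℕ (slot (uplink u)) ≤ toℕ (key u)
  slot-uplink u = go (uplink u) (uplink-shallower u)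
    where
    go : ∀ m → Maybe.All (λ a → depth a < depth u) m → toℕ (slot m) ≤ toℕ (key u)
    go nothing  _               = z≤n
    go (just a) (Maybe.just da<du) = key-< da<du

  -- Indices combine l v with l ≢ depth v belong to no vertex; clamp hangs those from Y_1.
  parentIndex : Fin k → Fin (suc k)
  parentIndex zero    = zero
  parentIndex (suc j) = suc (clamp (slot (uplink (vertexOf j))) j)

  parentIndex-≤ : ∀ i → toℕ (parentIndex i) ≤ toℕ i
  parentIndex-≤ zero    = z≤n
  parentIndex-≤ (suc j) = s≤s (clamp-≤ (slot (uplink (vertexOf j))) j)

  attachment : (i : Fin k) → Fin r → Fin (ysize r t (parentIndex i))
  attachment zero    = id
  attachment (suc j) = xset (vertexOf j)

  attachment-injective : ∀ i → Injective _≡_ _≡_ (attachment i)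
  attachment-injective zero    = id
  attachment-injective (suc j) = xset-injective (vertexOf j)

  L : BlownupTree r t k
  L = record { par = parentIndex ; par< = parentIndex-≤ ; emb = attachment ; embInj = attachment-injective }

  place : Fin k → Fin t → BTVertex r t k
  place i p = suc i , p

  φ : Fin N → BTVertex r t k
  φ x = place (slot (home (π x))) (x ↑ˡ r)

  xset-arc : ∀ u c b → proj₁ b ≡ suc (slot (just u)) → BTArc L (place (slot (uplink u)) (xset u c)) b
  xset-arc u c _ b∈Yu = suc (key u) , c , sym (hook (vertexOf-key u) (slot-uplink u)) , b∈Yu
    where
    hook : ∀ {j} → vertexOf j ≡ u → toℕ (slot (uplink u)) ≤ toℕ j →
           place (clamp (slot (uplink (vertexOf j))) j) (xset (vertexOf j) c) ≡ place (slot (uplink u)) (xset u c)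
    hook refl s≤j = cong (λ s → place s (xset u c)) (clamp-≡ s≤j)

  arc : ∀ u x b → home (π x) ≡ uplink u → wanted u x ≡ true → proj₁ b ≡ suc (slot (just u)) →
        BTArc L (φ x) b
  arc u x b x-home x-wanted b∈Yu with c , xc≡ ← xset-covers u x x-wanted =
    subst (λ a → BTArc L a b) (cong₂ place (cong slot (sym x-home)) xc≡) (xset-arc u c b b∈Yu)

  child-adj : ∀ {x y} → ChildOf (π y) (π x) → BTAdj L (φ x) (φ y)
  child-adj {x} {y} (py≡πx , dy≡) with large? (π x)
  ... | yes large = inj₂ (arc (π x) y (φ x) home-y (wanted-large large (edge-sym T (child-edge (py≡πx , dy≡))))
                                 (cong (suc ∘ slot) (home-large large)))
    where
    home-y : home (π y) ≡ uplink (π x)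
    home-y = trans (home-under-large dy≡ (subst Large (sym py≡πx) large)) (cong uplink py≡πx)
  ... | no small = inj₁ (arc (π y) x (φ y) home-x (wanted-parent (sym py≡πx) (child-edge (py≡πx , dy≡)) small-parent)
                             (cong (suc ∘ slot) (home-under-small dy≡ small-parent)))
    where
    small-parent : ¬ Large (parent (π y))
    small-parent = subst (¬_ ∘ Large) (sym py≡πx) small
    home-x : home (π x) ≡ uplink (π y)
    home-x = sym (trans (uplink≡home-parent dy≡) (cong home py≡πx))

  φ-embedding : IsEmbedding F L φ
  φ-embedding = injective , edges
    where
    injective : Injective _≡_ _≡_ φ
    injective {x} {y} φx≡φy = Finₚ.↑ˡ-injective r x y (Finₚ.toℕ-injective (cong (toℕ ∘ proj₂) φx≡φy))
    edges : ∀ x y → Edge F x y → BTAdj L (φ x) (φ y)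
    edges x y e with edge⇒child (trans (sym (proj₂ blowUp x y)) e)
    ... | inj₁ y-child = child-adj y-child
    ... | inj₂ x-child = swap (child-adj x-child)

mainTheorem5 : (r : ℕ) → 1 ≤ r → (T F : Graph) → IsTree T →
    (π : Fin (n F) → Fin (n T)) → IsBlowUpVia F T π → Degenerate r F →
    ∃[ t ] (r ≤ t) × ∃[ k ] (1 ≤ k) × Σ (BlownupTree r t k) λ L →
      Σ (Fin (n F) → BTVertex r t k) λ φ → IsEmbedding F L φ ×
        (∀ u → ∃[ i ] (∀ x → π x ≡ u → proj₁ (φ x) ≡ i))
mainTheorem5 r _ T F (nonempty , connected , acyclic) π blowUp degenerate =
  t , m≤n+m r N , k , s≤s z≤n , L , φ , φ-embedding ,
  λ u → suc (slot (home u)) , λ x πx≡u → cong (suc ∘ slot ∘ home) πx≡u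
  where open Embedding r T F (fromℕ< nonempty) connected acyclic π blowUp degenerate
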